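{- Let $R$ be a commutative ring which is not a field, $j\ge 2$ an integer, and $V=\{A\in R^{j\times j} : \det(A) \text{ is a proper element of } R\}$. Define $\le$ on $V$ by $A\le B$ iff $A=B$ or $\det(A)\mid\mid\det(B)$. Then $(V,\le)$ is a partially ordered set and the matrix graph $\mathrm{Mat}(R)$ is a partial order graph.
   Context: Rings have $1\neq0$. A proper element is a non-zero non-unit; $a\mid\mid b$ means $a\mid b$ and $b\nmid a$ in $R$. The matrix graph $\mathrm{Mat}(R)$ (for fixed $j$) has vertex set $V$, distinct $A,B$ adjacent iff $\det(A)\mid\mid\det(B)$ or $\det(B)\mid\mid\det(A)$. A partial order graph is a graph $G_A$ for a poset $(A,\le)$ with vertex set $A$, distinct vertices adjacent iff comparable. -}

module Defs where

open import Level using (Level; _⊔_)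
open import Data.Nat using (ℕ; zero; suc)
open import Data.Fin using (Fin; zero; suc; punchIn)
open import Data.Product using (Σ; ∃; _×_; _,_)
open import Data.Sum using (_⊎_)
open import Relation.Nullary using (¬_)
open import Relation.Binary using (Rel; Setoid; IsPartialOrder; Poset)
open import Function.Bundles using (Inverse; _⇔_)
open import Algebra.Bundles using (CommutativeRing)

record Graph (v e a : Level) : Set (Level.suc (v ⊔ e ⊔ a)) where
  field
    vertices : Setoid v e
  open Setoid vertices public renaming (Carrier to Vertex)
  field
    Adj : Vertex → Vertex → Set a

Comparable : ∀ {c ℓ₁ ℓ₂} (P : Poset c ℓ₁ ℓ₂) → Poset.Carrier P → Poset.Carrier P → Set ℓ₂
Comparable P x y = Poset._≤_ P x y ⊎ Poset._≤_ P y x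

-- G is a partial order graph: G is isomorphic to the partial order graph G_A
-- of some poset (A , ≤), i.e. there is a bijection (of vertex setoids) under
-- which distinct vertices are adjacent iff their images are comparable.
IsPartialOrderGraph : ∀ {v e a} (ℓ : Level) → Graph v e a → Set (Level.suc (v ⊔ e ⊔ ℓ) ⊔ a)
IsPartialOrderGraph {v} {e} ℓ G =
  Σ (Poset v e ℓ) λ P →
  Σ (Inverse (Graph.vertices G) (Poset.Eq.setoid P)) λ f →
    ∀ x y → ¬ Graph._≈_ G x y →
      (Graph.Adj G x y ⇔ Comparable P (Inverse.to f x) (Inverse.to f y))

module _ {c ℓ} (R : CommutativeRing c ℓ) where
  open CommutativeRing R hiding (zero)

  Divides : Carrier → Carrier → Set (c ⊔ ℓ)
  Divides a b = ∃ λ q → b ≈ a * q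

  StrictDivides : Carrier → Carrier → Set (c ⊔ ℓ)
  StrictDivides a b = Divides a b × ¬ Divides b a

  IsUnit : Carrier → Set (c ⊔ ℓ)
  IsUnit a = ∃ λ b → a * b ≈ 1#

  Proper : Carrier → Set (c ⊔ ℓ)
  Proper a = ¬ (a ≈ 0#) × ¬ IsUnit a

  IsFieldRing : Set (c ⊔ ℓ)
  IsFieldRing = ∀ a → ¬ (a ≈ 0#) → IsUnit a

  Matrix : ℕ → Set c
  Matrix j = Fin j → Fin j → Carrier

  _≈ₘ_ : ∀ {j} → Matrix j → Matrix j → Set ℓ
  A ≈ₘ B = ∀ r s → A r s ≈ B r s

  altSum : ∀ {n} → (Fin n → Carrier) → Carrier
  altSum {zero}  f = 0#
  altSum {suc n} f = f zero - altSum (λ i → f (suc i))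

  minor : ∀ {n} → Fin (suc n) → Matrix (suc n) → Matrix n
  minor i A r s = A (suc r) (punchIn i s)

  det : ∀ {n} → Matrix n → Carrier
  det {zero}  A = 1#
  det {suc n} A = altSum (λ i → A zero i * det (minor i A))

  V : ℕ → Set (c ⊔ ℓ)
  V j = Σ (Matrix j) λ A → Proper (det A)

  _≈V_ : ∀ {j} → V j → V j → Set ℓ
  (A , _) ≈V (B , _) = A ≈ₘ B

  _≤V_ : ∀ {j} → V j → V j → Set (c ⊔ ℓ)
  (A , _) ≤V (B , _) = A ≈ₘ B ⊎ StrictDivides (det A) (det B)

  VSetoid : ℕ → Setoid (c ⊔ ℓ) ℓ
  VSetoid j = record
    { Carrier = V j
    ; _≈_ = _≈V_
    ; isEquivalence = record
      { refl = λ r s → refl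
      ; sym = λ p r s → sym (p r s)
      ; trans = λ p q r s → trans (p r s) (q r s) } }

  MatGraph : ℕ → Graph (c ⊔ ℓ) ℓ (c ⊔ ℓ)
  MatGraph j = record
    { vertices = VSetoid j
    ; Adj = λ { (A , _) (B , _) → StrictDivides (det A) (det B) ⊎ StrictDivides (det B) (det A) } }

-- The proof is order-theoretic and works for any commutative ring R
-- and any size j.
--
--   1. Strict divisibility a ∣∣ b is a strict partial order on R
--      (with respect to the ring equality).
--   2. A strict partial order pulls back along any map preserving
--      equality; the determinant preserves equality of matrices, so
--      "det A ∣∣ det B" is a strict partial order on V.
--   3. For any strict partial order <, the relation "x ≈ y or x < y"
--      is a partial order, and two distinct elements are comparable in
--      it iff x < y or y < x.  Applied to V this gives the poset (V, ≤)
--      and shows that the identity map identifies Mat(R) with the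
--      partial order graph of (V, ≤).

module Submission where

open import Defs
open import Level using (_⊔_)
open import Data.Nat using (ℕ; zero; suc; _≤_)
open import Data.Fin using (Fin; zero; suc; punchIn)
open import Data.Product using (_×_; _,_; proj₁; proj₂)
open import Data.Sum using (_⊎_; inj₁; inj₂)
open import Data.Empty using (⊥-elim)
open import Relation.Nullary using (¬_)
open import Relation.Binary using (Rel; Setoid; IsEquivalence; IsPartialOrder; IsStrictPartialOrder; Poset)
open import Algebra.Bundles using (CommutativeRing)
open import Function.Bundles using (_⇔_; mk⇔)
import Function.Construct.Identity as Identity

module ReflexiveClosure {a ℓ₁ ℓ₂} {A : Set a} {_≈_ : Rel A ℓ₁} {_<_ : Rel A ℓ₂}
                        (spo : IsStrictPartialOrder _≈_ _<_) where
  open IsStrictPartialOrder spo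

  _≼_ : Rel A (ℓ₁ ⊔ ℓ₂)
  x ≼ y = x ≈ y ⊎ x < y

  -- "x ≈ y or x < y" is a partial order; antisymmetry holds because
  -- x < y < x would give x < x.
  isPartialOrder : IsPartialOrder _≈_ _≼_
  isPartialOrder = record
    { isPreorder = record
      { isEquivalence = isEquivalence
      ; reflexive     = inj₁
      ; trans         = ≼-trans }
    ; antisym = ≼-antisym }
    where
    ≼-trans : ∀ {x y z} → x ≼ y → y ≼ z → x ≼ z
    ≼-trans (inj₁ x≈y) (inj₁ y≈z) = inj₁ (Eq.trans x≈y y≈z)
    ≼-trans (inj₁ x≈y) (inj₂ y<z) = inj₂ (proj₂ <-resp-≈ (Eq.sym x≈y) y<z)
    ≼-trans (inj₂ x<y) (inj₁ y≈z) = inj₂ (proj₁ <-resp-≈ y≈z x<y)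
    ≼-trans (inj₂ x<y) (inj₂ y<z) = inj₂ (trans x<y y<z)

    ≼-antisym : ∀ {x y} → x ≼ y → y ≼ x → x ≈ y
    ≼-antisym (inj₁ x≈y) _          = x≈y
    ≼-antisym (inj₂ _)   (inj₁ y≈x) = Eq.sym y≈x
    ≼-antisym (inj₂ x<y) (inj₂ y<x) = ⊥-elim (irrefl Eq.refl (trans x<y y<x))

  poset : Poset a ℓ₁ (ℓ₁ ⊔ ℓ₂)
  poset = record { isPartialOrder = isPartialOrder }

  distinct-comparable⇔ : ∀ {x y} → ¬ x ≈ y → (x < y ⊎ y < x) ⇔ Comparable poset x y
  distinct-comparable⇔ {x} {y} x≉y = mk⇔ to from
    where
    to : x < y ⊎ y < x → Comparable poset x y
    to (inj₁ x<y) = inj₁ (inj₂ x<y)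
    to (inj₂ y<x) = inj₂ (inj₂ y<x)

    from : Comparable poset x y → x < y ⊎ y < x
    from (inj₁ (inj₁ x≈y)) = ⊥-elim (x≉y x≈y)
    from (inj₁ (inj₂ x<y)) = inj₁ x<y
    from (inj₂ (inj₁ y≈x)) = ⊥-elim (x≉y (Eq.sym y≈x))
    from (inj₂ (inj₂ y<x)) = inj₂ y<x

pullback-isStrictPartialOrder :
  ∀ {a b ℓ₁ ℓ₂ ℓ₃} {A : Set a} {B : Set b}
    {_≈ᴬ_ : Rel A ℓ₁} {_≈ᴮ_ : Rel B ℓ₂} {_<_ : Rel B ℓ₃} (f : A → B) →
  IsEquivalence _≈ᴬ_ → (∀ {x y} → x ≈ᴬ y → f x ≈ᴮ f y) →
  IsStrictPartialOrder _≈ᴮ_ _<_ →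
  IsStrictPartialOrder _≈ᴬ_ (λ x y → f x < f y)
pullback-isStrictPartialOrder f ≈ᴬ-isEquivalence f-cong spo = record
  { isEquivalence = ≈ᴬ-isEquivalence
  ; irrefl        = λ x≈y → irrefl (f-cong x≈y)
  ; trans         = trans
  ; <-resp-≈      = (λ y≈z → proj₁ <-resp-≈ (f-cong y≈z))
                  , (λ x≈z → proj₂ <-resp-≈ (f-cong x≈z)) }
  where
  open IsStrictPartialOrder spo hiding (isEquivalence)

module _ {c ℓ} (R : CommutativeRing c ℓ) where
  open CommutativeRing R hiding (zero)

  divides-resp-≈ : ∀ {a a′ b b′} → a ≈ a′ → b ≈ b′ → Divides R a b → Divides R a′ b′
  divides-resp-≈ a≈a′ b≈b′ (q , b≈aq) = q , trans (sym b≈b′) (trans b≈aq (*-congʳ a≈a′))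

  divides-trans : ∀ {a b d} → Divides R a b → Divides R b d → Divides R a d
  divides-trans {a} (q , b≈aq) (q′ , d≈bq′) =
    q * q′ , trans d≈bq′ (trans (*-congʳ b≈aq) (*-assoc a q q′))

  strictDivides-isStrictPartialOrder : IsStrictPartialOrder _≈_ (StrictDivides R)
  strictDivides-isStrictPartialOrder = record
    { isEquivalence = isEquivalence
    ; irrefl        = λ a≈b (_ , b∤a) → b∤a (divides-resp-≈ a≈b refl (1# , sym (*-identityʳ _)))
    ; trans         = λ (a∣b , b∤a) (b∣d , d∤b) → divides-trans a∣b b∣d
                                                , λ d∣a → d∤b (divides-trans d∣a a∣b)
    ; <-resp-≈      = (λ b≈b′ → resp refl b≈b′) , (λ a≈a′ → resp a≈a′ refl) }
    where
    resp : ∀ {a a′ b b′} → a ≈ a′ → b ≈ b′ → StrictDivides R a b → StrictDivides R a′ b′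
    resp a≈a′ b≈b′ (a∣b , b∤a) =
      divides-resp-≈ a≈a′ b≈b′ a∣b , λ b′∣a′ → b∤a (divides-resp-≈ (sym b≈b′) (sym a≈a′) b′∣a′)

  altSum-cong : ∀ {n} {f g : Fin n → Carrier} → (∀ i → f i ≈ g i) → altSum R f ≈ altSum R g
  altSum-cong {zero}  f≈g = refl
  altSum-cong {suc n} f≈g = +-cong (f≈g zero) (-‿cong (altSum-cong (λ i → f≈g (suc i))))

  det-cong : ∀ {n} {A B : Matrix R n} → _≈ₘ_ R A B → det R A ≈ det R B
  det-cong {zero}  A≈B = refl
  det-cong {suc n} A≈B =
    altSum-cong (λ i → *-cong (A≈B zero i) (det-cong (λ r s → A≈B (suc r) (punchIn i s))))

  -- On V, "det A ∣∣ det B" is a strict partial order; ≤V is its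
  -- reflexive closure.
  module VOrder (j : ℕ) =
    ReflexiveClosure (pullback-isStrictPartialOrder (λ (A : V R j) → det R (proj₁ A))
                        (Setoid.isEquivalence (VSetoid R j)) det-cong
                        strictDivides-isStrictPartialOrder)

lemma3p15 : ∀ {c ℓ} (R : CommutativeRing c ℓ) →
    ¬ (CommutativeRing._≈_ R (CommutativeRing.1# R) (CommutativeRing.0# R)) →
    ¬ IsFieldRing R →
    (j : ℕ) → 2 ≤ j →
    IsPartialOrder (_≈V_ R {j}) (_≤V_ R {j})
    × IsPartialOrderGraph (c ⊔ ℓ) (MatGraph R j)
-- (V, ≤) is the poset of VOrder, and the identity map on V identifies
-- Mat(R) with its partial order graph.
lemma3p15 R _ _ j _ =
  isPartialOrder , poset , Identity.inverse (VSetoid R j) , λ x y → distinct-comparable⇔ {x} {y}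
  where open VOrder R j
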